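{- Let $G$ be a connected graph and $r\in V(G)$ with $\deg(r)=|V(G)|-1$. Then $\eta(G,r)=|V(G)|$.
   Context: All graphs are finite, simple and connected. A configuration $C$ on $G$ is a function $C:V(G)\to\mathbb{Z}_{\ge 0}$; its size is $\sum_v C(v)$. A pebbling move removes two pebbles from a vertex and places one pebble on an adjacent vertex. The Two-Player Pebbling Game on $G$ with root $r$ and starting configuration $C$ is played by Mover and Defender in rounds: in each round Mover makes a pebbling move and then Defender makes a pebbling move; each player must take their turn. If Mover pebbles from $u$ to $v$, Defender may not pebble from $v$ to $u$ in the same round. Mover wins if at any time the root has at least one pebble; Defender wins if the root has no pebble and there are no more pebbling moves. A winning strategy is a rule choosing a player's moves as a function of the current position which guarantees that player wins. $\eta(G,r)$ is the minimum $m$ such that for every configuration of $m$ pebbles Mover has a winning strategy; if for arbitrarily large $m$ there is a configuration of size greater than $m$ on which Defender has a winning strategy, then $\eta(G,r)=\infty$. -}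

module Defs where

open import Data.Nat using (ℕ; zero; suc; _≤_; _<_; _∸_)
open import Data.Fin using (Fin; _≟_)
open import Data.Bool using (Bool; true; false; if_then_else_)
open import Data.List using (List; map; allFin)
open import Data.Nat.ListAction using (sum)
open import Data.Product using (Σ; _×_; _,_; ∃; ∃-syntax)
open import Data.Sum using (_⊎_)
open import Data.Empty using (⊥)
open import Relation.Nullary using (¬_; does)
open import Relation.Binary.PropositionalEquality using (_≡_)

record Graph (n : ℕ) : Set where
  field
    adj   : Fin n → Fin n → Bool
    sym   : ∀ u v → adj u v ≡ adj v u
    irrefl : ∀ v → adj v v ≡ false

open Graph public

data Walk {n : ℕ} (G : Graph n) : Fin n → Fin n → Set where
  here : ∀ {u} → Walk G u u
  step : ∀ {u w v} → adj G u w ≡ true → Walk G w v → Walk G u v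

Connected : ∀ {n} → Graph n → Set
Connected {n} G = ∀ (u v : Fin n) → Walk G u v

deg : ∀ {n} → Graph n → Fin n → ℕ
deg {n} G r = sum (map (λ v → if adj G r v then 1 else 0) (allFin n))

Config : ℕ → Set
Config n = Fin n → ℕ

size : ∀ {n} → Config n → ℕ
size {n} C = sum (map C (allFin n))

Legal : ∀ {n} → Graph n → Config n → Fin n → Fin n → Set
Legal G C u v = (adj G u v ≡ true) × (2 ≤ C u)

apply : ∀ {n} → Config n → Fin n → Fin n → Config n
apply C u v x =
  if does (x ≟ u) then C u ∸ 2
  else if does (x ≟ v) then suc (C v) else C x

-- MoverWins G r C      : Mover to move at C; Mover has a winning strategy.
-- MoverWinsD G r C a b : Defender to move at C, where Mover has just pebbled
--                        from b to a, so Defender may not pebble from a to b;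
--                        Mover has a winning strategy.
-- (The game terminates since every move decreases the size, so winning
--  strategies are exactly well-founded strategy trees.)
-- If the player to move has no legal pebbling move, the game is over.
mutual
  data MoverWins {n : ℕ} (G : Graph n) (r : Fin n) (C : Config n) : Set where
    rootM : 1 ≤ C r → MoverWins G r C
    moveM : ∀ u v → Legal G C u v → MoverWinsD G r (apply C u v) v u →
            MoverWins G r C

  data MoverWinsD {n : ℕ} (G : Graph n) (r : Fin n) (C : Config n)
                  (a b : Fin n) : Set where
    rootD : 1 ≤ C r → MoverWinsD G r C a b
    allD  : (∃[ u ] ∃[ v ] (Legal G C u v × ¬ ((u ≡ a) × (v ≡ b)))) →
            (∀ u v → Legal G C u v → ¬ ((u ≡ a) × (v ≡ b)) →
               MoverWins G r (apply C u v)) →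
            MoverWinsD G r C a b

-- DefenderWins G r C      : Mover to move at C; Defender has a winning strategy.
-- DefenderWinsD G r C a b : Defender to move at C (may not pebble a → b).
mutual
  data DefenderWins {n : ℕ} (G : Graph n) (r : Fin n) (C : Config n) : Set where
    allM : C r ≡ 0 →
           (∀ u v → Legal G C u v → DefenderWinsD G r (apply C u v) v u) →
           DefenderWins G r C

  data DefenderWinsD {n : ℕ} (G : Graph n) (r : Fin n) (C : Config n)
                     (a b : Fin n) : Set where
    stuckD : C r ≡ 0 →
             (∀ u v → Legal G C u v → ¬ ((u ≡ a) × (v ≡ b)) → ⊥) →
             DefenderWinsD G r C a b
    moveD  : C r ≡ 0 → ∀ u v → Legal G C u v → ¬ ((u ≡ a) × (v ≡ b)) →
             DefenderWins G r (apply C u v) →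
             DefenderWinsD G r C a b

MoverWinsAll : ∀ {n} → Graph n → Fin n → ℕ → Set
MoverWinsAll {n} G r m = ∀ (C : Config n) → size C ≡ m → MoverWins G r C

-- η(G,r) = ∞ condition: arbitrarily large Defender-win configurations.
EtaInfinite : ∀ {n} → Graph n → Fin n → Set
EtaInfinite {n} G r = ∀ (m : ℕ) → ∃[ C ] ((m < size C) × DefenderWins G r C)

-- η(G,r) = m (finite value): not the infinite case, and m is the minimum
-- value with the property MoverWinsAll.
Eta≡ : ∀ {n} → Graph n → Fin n → ℕ → Set
Eta≡ G r m = ¬ EtaInfinite G r × MoverWinsAll G r m
             × (∀ k → k < m → ¬ MoverWinsAll G r k)

module Submission where

-- Let n+1 = |V(G)| and let r be adjacent to every other
-- vertex.  Both bounds for η(G,r) = n+1 come from one counting fact: a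
-- configuration with at most one pebble per vertex and an empty vertex has
-- fewer pebbles than vertices.  Hence
--   * (upper bound) with at least n+1 pebbles and the root empty, some vertex
--     u ≠ r holds two pebbles; u is adjacent to r, so Mover pebbles u → r and
--     wins at once.  This also rules out η = ∞;
--   * (lower bound) for every k ≤ n there is a configuration of size k with at
--     most one pebble per vertex and none on r; Mover has no move there, so
--     Defender wins.

open import Defs renaming (sym to adj-sym)
open import Data.Nat using (ℕ; zero; suc; _+_; _∸_; _≤_; _<_; z≤n; s≤s; _≤?_)
open import Data.Nat.Properties
  using (≤-refl; ≤-reflexive; ≤-trans; <-irrefl; +-mono-≤; ≰⇒>; n≤1+n;
         +-0-commutativeMonoid)
open import Data.Fin using (Fin; zero; suc; _≟_; punchIn; punchOut)
open import Data.Fin.Properties using (¬∀⟶∃¬; punchIn-punchOut)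
open import Data.Vec.Functional using (insertAt)
open import Data.Vec.Functional.Properties using (insertAt-lookup; insertAt-punchIn)
open import Data.List using (tabulate)
open import Data.List.Properties using (map-tabulate)
open import Data.Nat.ListAction using (sum)
open import Algebra.Properties.CommutativeMonoid.Sum +-0-commutativeMonoid
  using (sum-remove; sum-cong-≗; sum-replicate-zero)
  renaming (sum to ∑)
open import Data.Bool using (Bool; true; false; if_then_else_)
open import Data.Product using (_,_; ∃-syntax; map₂)
open import Data.Empty using (⊥)
open import Relation.Nullary using (¬_; yes; no; contradiction)
open import Relation.Nullary.Decidable using (dec-true; dec-false)
open import Relation.Binary.PropositionalEquality
  using (_≡_; _≢_; refl; sym; trans; cong; subst; module ≡-Reasoning)

sum-tabulate : ∀ {n} (f : Fin n → ℕ) → sum (tabulate f) ≡ ∑ f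
sum-tabulate {zero}  f = refl
sum-tabulate {suc n} f = cong (f zero +_) (sum-tabulate (λ i → f (suc i)))

size≡∑ : ∀ {n} (C : Config n) → size C ≡ ∑ C
size≡∑ C = trans (cong sum (map-tabulate (λ i → i) C)) (sum-tabulate C)

∑-drop-zero : ∀ {n} (f : Fin (suc n) → ℕ) (i : Fin (suc n)) →
              f i ≡ 0 → ∑ f ≡ ∑ (λ j → f (punchIn i j))
∑-drop-zero f i fi≡0 = trans (sum-remove {i = i} f) (cong (_+ ∑ (λ j → f (punchIn i j))) fi≡0)

∑-≤1 : ∀ {n} (f : Fin n → ℕ) → (∀ i → f i ≤ 1) → ∑ f ≤ n
∑-≤1 {zero}  f f≤1 = z≤n
∑-≤1 {suc n} f f≤1 = +-mono-≤ (f≤1 zero) (∑-≤1 (λ i → f (suc i)) (λ i → f≤1 (suc i)))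

∑-≤1-hole : ∀ {n} (f : Fin n → ℕ) (i : Fin n) →
            (∀ j → f j ≤ 1) → f i ≡ 0 → suc (∑ f) ≤ n
∑-≤1-hole {suc n} f i f≤1 fi≡0 =
  s≤s (subst (_≤ n) (sym (∑-drop-zero f i fi≡0)) (∑-≤1 _ (λ j → f≤1 (punchIn i j))))

crowdedVertex : ∀ {n} (C : Config n) (r : Fin n) →
                C r ≡ 0 → n ≤ size C → ∃[ u ] (2 ≤ C u)
crowdedVertex {n} C r Cr≡0 n≤size =
  map₂ ≰⇒> (¬∀⟶∃¬ n (λ u → C u ≤ 1) (λ u → C u ≤? 1) notSparse)
  where
  notSparse : ¬ (∀ u → C u ≤ 1)
  notSparse C≤1 = <-irrefl refl (≤-trans (s≤s (subst (n ≤_) (size≡∑ C) n≤size))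
                                         (∑-≤1-hole C r C≤1 Cr≡0))

indicator : Bool → ℕ
indicator b = if b then 1 else 0

indicator≤1 : ∀ b → indicator b ≤ 1
indicator≤1 true  = ≤-refl
indicator≤1 false = z≤n

-- Removing the (non-adjacent) vertex r itself, the n remaining indicators
-- sum to deg r = n, so none of them can vanish.
dominating : ∀ {n} (G : Graph (suc n)) (r : Fin (suc n)) → deg G r ≡ n →
             ∀ x → r ≢ x → adj G r x ≡ true
dominating {n} G r deg≡n x r≢x with adj G r x in rx
... | true  = refl
... | false =
  contradiction (∑-≤1-hole others (punchOut r≢x) (λ j → indicator≤1 (adj G r (punchIn r j))) hole)
                (<-irrefl others≡n)
  where
  others : Fin n → ℕ
  others j = indicator (adj G r (punchIn r j))
  hole : others (punchOut r≢x) ≡ 0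
  hole = trans (cong (λ y → indicator (adj G r y)) (punchIn-punchOut r≢x)) (cong indicator rx)
  others≡n : ∑ others ≡ n
  others≡n = begin
    ∑ others                                   ≡⟨ ∑-drop-zero (λ v → indicator (adj G r v)) r
                                                    (cong indicator (irrefl G r)) ⟨
    ∑ (λ v → indicator (adj G r v))            ≡⟨ size≡∑ (λ v → indicator (adj G r v)) ⟨
    deg G r                                    ≡⟨ deg≡n ⟩
    n                                          ∎
    where open ≡-Reasoning

firstOnes : ∀ {n} → ℕ → Fin n → ℕ
firstOnes zero    _       = 0
firstOnes (suc k) zero    = 1
firstOnes (suc k) (suc i) = firstOnes k i

firstOnes≤1 : ∀ {n} k (i : Fin n) → firstOnes k i ≤ 1
firstOnes≤1 zero    _       = z≤n
firstOnes≤1 (suc k) zero    = ≤-refl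
firstOnes≤1 (suc k) (suc i) = firstOnes≤1 k i

∑-firstOnes : ∀ {n} k → k ≤ n → ∑ {n} (firstOnes k) ≡ k
∑-firstOnes {n}     zero    _         = sum-replicate-zero n
∑-firstOnes {suc n} (suc k) (s≤s k≤n) = cong suc (∑-firstOnes k k≤n)

insertAt-all : ∀ {a p} {A : Set a} {n} (P : A → Set p) (xs : Fin n → A)
               (i : Fin (suc n)) (v : A) →
               P v → (∀ j → P (xs j)) → ∀ x → P (insertAt xs i v x)
insertAt-all P xs i v Pv Pxs x with i ≟ x
... | yes refl = subst P (sym (insertAt-lookup xs i v)) Pv
... | no i≢x   = subst P (cong (insertAt xs i v) (punchIn-punchOut i≢x))
                         (subst P (sym (insertAt-punchIn xs i v (punchOut i≢x)))
                                  (Pxs (punchOut i≢x)))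

sparse : ∀ {n} → Fin (suc n) → ℕ → Config (suc n)
sparse r k = insertAt (firstOnes k) r 0

sparse-root : ∀ {n} (r : Fin (suc n)) k → sparse r k r ≡ 0
sparse-root r k = insertAt-lookup (firstOnes k) r 0

sparse-≤1 : ∀ {n} (r : Fin (suc n)) k → ∀ x → sparse r k x ≤ 1
sparse-≤1 r k = insertAt-all (_≤ 1) (firstOnes k) r 0 z≤n (firstOnes≤1 k)

sparse-size : ∀ {n} (r : Fin (suc n)) k → k ≤ n → size (sparse r k) ≡ k
sparse-size {n} r k k≤n = begin
  size (sparse r k)                            ≡⟨ size≡∑ (sparse r k) ⟩
  ∑ (sparse r k)                               ≡⟨ ∑-drop-zero (sparse r k) r (sparse-root r k) ⟩
  ∑ (λ j → sparse r k (punchIn r j))           ≡⟨ sum-cong-≗ (insertAt-punchIn (firstOnes k) r 0) ⟩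
  ∑ {n} (firstOnes k)                          ≡⟨ ∑-firstOnes k k≤n ⟩
  k                                            ∎
  where open ≡-Reasoning

occupied-not-empty : ∀ {m} → 1 ≤ m → m ≡ 0 → ⊥
occupied-not-empty (s≤s _) ()

-- Mover and Defender cannot both have a winning strategy from the same
-- position: follow Mover's strategy against Defender's until one of them
-- claims a position that the other refutes.
mutual
  exclusive : ∀ {n} {G : Graph n} {r C} → MoverWins G r C → ¬ DefenderWins G r C
  exclusive (rootM root≥1)     (allM root≡0 _)    = occupied-not-empty root≥1 root≡0
  exclusive (moveM u v legal w) (allM _ defender) = exclusiveD w (defender u v legal)

  exclusiveD : ∀ {n} {G : Graph n} {r C a b} →
               MoverWinsD G r C a b → ¬ DefenderWinsD G r C a b
  exclusiveD (rootD root≥1) (stuckD root≡0 _)       = occupied-not-empty root≥1 root≡0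
  exclusiveD (rootD root≥1) (moveD root≡0 _ _ _ _ _) = occupied-not-empty root≥1 root≡0
  exclusiveD (allD (u , v , legal , allowed) _) (stuckD _ stuck) = stuck u v legal allowed
  exclusiveD (allD _ mover) (moveD _ u v legal allowed d) = exclusive (mover u v legal allowed) d

-- With at most one pebble per vertex Mover cannot move; if moreover the
-- root is empty, Defender has won.
stuckDefenderWins : ∀ {n} (G : Graph n) (r : Fin n) (C : Config n) →
                    C r ≡ 0 → (∀ x → C x ≤ 1) → DefenderWins G r C
stuckDefenderWins G r C Cr≡0 C≤1 =
  allM Cr≡0 (λ u v (_ , 2≤Cu) → contradiction (≤-trans 2≤Cu (C≤1 u)) (<-irrefl refl))

apply-target : ∀ {n} (C : Config n) u v → v ≢ u → apply C u v v ≡ suc (C v)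
apply-target C u v v≢u rewrite dec-false (v ≟ u) v≢u | dec-true (v ≟ v) refl = refl

oneMoveWin : ∀ {n} (G : Graph n) (r : Fin n) (C : Config n) u →
             adj G u r ≡ true → 2 ≤ C u → r ≢ u → MoverWins G r C
oneMoveWin G r C u ur 2≤Cu r≢u =
  moveM u r (ur , 2≤Cu) (rootD (subst (1 ≤_) (sym (apply-target C u r r≢u)) (s≤s z≤n)))

-- If r is adjacent to all other vertices, Mover wins from every
-- configuration with at least |V(G)| pebbles: either the root is occupied,
-- or some vertex u ≠ r holds two pebbles and can pebble onto r.
moverWinsLarge : ∀ {n} (G : Graph (suc n)) (r : Fin (suc n)) → deg G r ≡ n →
                 (C : Config (suc n)) → suc n ≤ size C → MoverWins G r C
moverWinsLarge G r deg≡n C large with C r in Cr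
... | suc _ = rootM (subst (1 ≤_) (sym Cr) (s≤s z≤n))
... | zero  with crowdedVertex C r Cr large
...   | u , 2≤Cu = oneMoveWin G r C u
                     (trans (adj-sym G u r) (dominating G r deg≡n u r≢u))
                     2≤Cu r≢u
  where
  r≢u : r ≢ u
  r≢u refl = contradiction (subst (2 ≤_) Cr 2≤Cu) λ ()

proposition2p2 : (n : ℕ) (G : Graph n) → Connected G → (r : Fin n) →
                 deg G r ≡ n ∸ 1 → Eta≡ G r n
proposition2p2 zero    G _ ()
proposition2p2 (suc n) G _ r deg≡n = notInfinite , enough , notEnough
  where
  enough : MoverWinsAll G r (suc n)
  enough C size≡ = moverWinsLarge G r deg≡n C (≤-reflexive (sym size≡))

  -- Every configuration larger than |V(G)| is a Mover win, hence no
  -- Defender win.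
  notInfinite : ¬ EtaInfinite G r
  notInfinite infinite with infinite (suc n)
  ... | C , larger , defender =
    exclusive (moverWinsLarge G r deg≡n C (≤-trans (n≤1+n _) larger)) defender

  -- For k ≤ n the sparse configuration of size k is a Defender win.
  notEnough : ∀ k → k < suc n → ¬ MoverWinsAll G r k
  notEnough k (s≤s k≤n) allWin =
    exclusive (allWin (sparse r k) (sparse-size r k k≤n))
              (stuckDefenderWins G r (sparse r k) (sparse-root r k) (sparse-≤1 r k))
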